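{- Let $G$ be an $r$-uniform multi-hypergraph on vertex set $V$ with $m$ edges, and let $V_1,V_2,\ldots,V_r$ be a partition of $V$ such that $\sum_{i=1}^r d(V_i)$ cannot be increased by moving a single vertex (from some $V_i$, $i<r$) into $V_r$. Then $$\sum_{i=1}^r d(V_i)\ge (r+1)m-r\,d(V_r).$$
   Context: An $r$-uniform multi-hypergraph on a finite vertex set $V$ is a finite multiset of $r$-element subsets of $V$ (edges), repeated edges allowed and counted with multiplicity; $r\ge 2$ is an integer. For $X\subseteq V$, $d(X)$ denotes the number of edges meeting $X$ (having nonempty intersection with $X$), counted with multiplicity. -}

module Defs where

open import Data.Nat using (ℕ; suc)
open import Data.Fin using (Fin; _≟_)
open import Data.Fin.Subset using (Subset; _∩_; ∣_∣)
open import Data.Fin.Subset.Properties using (nonempty?)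
open import Data.List using (List; length; filter; map; allFin)
open import Data.Nat.ListAction using (sum)
open import Data.List.Relation.Unary.All using (All)
open import Data.Vec using (tabulate; _[_]≔_)
open import Relation.Nullary using (does)
import Data.Bool
open import Relation.Binary.PropositionalEquality using (_≡_)

-- An r-uniform multi-hypergraph on vertex set Fin n: a list (multiset) of
-- subsets of Fin n, each of cardinality r (repeats allowed).
Uniform : ∀ {n} → ℕ → List (Subset n) → Set
Uniform r E = All (λ e → ∣ e ∣ ≡ r) E

deg : ∀ {n} → List (Subset n) → Subset n → ℕ
deg E X = length (filter (λ e → nonempty? (e ∩ X)) E)

-- A partition V_1,…,V_r of Fin n, given by the part-assignment p : Fin n → Fin r.
part : ∀ {n r} → (Fin n → Fin r) → Fin r → Subset n
part p i = tabulate (λ v → does (p v ≟ i))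

degSum : ∀ {n r} → List (Subset n) → (Fin n → Fin r) → ℕ
degSum {r = r} E p = sum (map (λ i → deg E (part p i)) (allFin r))

move : ∀ {n r} → (Fin n → Fin r) → Fin n → Fin r → (Fin n → Fin r)
move p v j w with does (w ≟ v)
... | Data.Bool.true = j
... | Data.Bool.false = p w

-- For an edge e write sᵢ = |e ∩ Vᵢ|; e contributes to ∑ d(Vᵢ) the number of parts it
-- meets.  Moving a vertex v ∉ V_r into V_r gains the edges through v that miss V_r and
-- loses the edges meeting the part of v only in v, so by local optimality the gain is at
-- most the loss for every v.  Summed over v, each edge missing V_r is gained r times,
-- and each edge is lost once for every part other than V_r that it meets in exactly one
-- vertex.  An edge has r vertices and there are r parts, so an edge missing V_r has two
-- vertices in one part; hence every edge meets more parts than it has such singleton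
-- parts, and adding these inequalities over all edges gives the bound.

module Submission where

open import Defs
open import Data.Nat using (ℕ; zero; suc; _+_; _*_; _≤_; _<_; z≤n; s≤s)
open import Data.Nat.Properties
  using (+-*-semiring; +-commutativeSemigroup; *-commutativeSemigroup; +-monoˡ-≤; +-comm; +-identityʳ;
         *-identityˡ; *-identityʳ; *-zeroʳ; *-assoc;
         *-distribˡ-+; +-mono-≤; +-monoʳ-≤; ≤-refl; ≤-reflexive; ≤-trans; +-cancelˡ-≤;
         n≤1+n; module ≤-Reasoning)
open import Data.Bool using (Bool; true; false; _∧_; not)
open import Data.Fin using (Fin; zero; suc; fromℕ; _≟_; punchIn)
open import Data.Fin.Properties using (punchInᵢ≢i)
open import Data.Fin.Subset using (Subset; _∩_; ∣_∣)
open import Data.Fin.Subset.Properties using (nonempty?; x∈p⇒∣p-x∣<∣p∣; Empty-unique; ∣⊥∣≡0; x∈p∩q⁺)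
open import Data.List as List using (List; []; _∷_; length; filter; map; allFin)
import Data.List.Properties as List
open import Data.List.Membership.Propositional.Properties using (∈-lookup)
import Data.List.Relation.Unary.All as All
import Data.Nat.ListAction as ListAction
open import Data.Vec using (lookup; _∷_; [])
open import Data.Vec.Properties using (lookup-zipWith; lookup∘tabulate; lookup⇒[]=)
open import Data.Vec.Functional using (Vector; removeAt)
open import Data.Product using (_,_)
open import Function using (_∘_)
open import Relation.Nullary using (Dec; does; yes; no; ¬?; contradiction)
open import Relation.Nullary.Decidable using (dec-true; dec-false)
open import Relation.Unary using (Pred; Decidable)
open import Relation.Binary.PropositionalEquality
  using (_≡_; _≢_; refl; sym; trans; cong; cong₂; subst; subst₂; module ≡-Reasoning)

open import Algebra.Properties.CommutativeSemigroup +-commutativeSemigroup using () renaming (x∙yz≈y∙xz to +-left-comm)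
open import Algebra.Properties.CommutativeSemigroup *-commutativeSemigroup using () renaming (x∙yz≈y∙xz to *-left-comm)
open import Algebra.Properties.Semiring.Sum +-*-semiring
  using (sum; sum-syntax; sum-cong-≗; sum-remove; sum-replicate-zero; ∑-distrib-+; ∑-comm;
         *-distribˡ-sum; *-distribʳ-sum)

private
  variable
    n r : ℕ

𝟙 : Bool → ℕ
𝟙 true  = 1
𝟙 false = 0

⟦_⟧ : ∀ {a} {A : Set a} → Dec A → ℕ
⟦ a? ⟧ = 𝟙 (does a?)

[_≡0] [_≡1] [_≢0] : ℕ → ℕ
[ zero ≡0] = 1
[ suc _ ≡0] = 0
[ 1 ≡1] = 1
[ _ ≡1] = 0
[ zero ≢0] = 0
[ suc _ ≢0] = 1

⟦≟⟧-refl : (i : Fin n) → ⟦ i ≟ i ⟧ ≡ 1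
⟦≟⟧-refl i = cong 𝟙 (dec-true (i ≟ i) refl)

⟦≟⟧-≢ : {i j : Fin n} → i ≢ j → ⟦ i ≟ j ⟧ ≡ 0
⟦≟⟧-≢ {i = i} {j} i≢j = cong 𝟙 (dec-false (i ≟ j) i≢j)

𝟙-∧ : ∀ a b → 𝟙 (a ∧ b) ≡ 𝟙 a * 𝟙 b
𝟙-∧ true  b = sym (+-identityʳ (𝟙 b))
𝟙-∧ false b = refl

[≡1]≤[≢0] : ∀ x → [ x ≡1] ≤ [ x ≢0]
[≡1]≤[≢0] zero          = z≤n
[≡1]≤[≢0] (suc zero)    = ≤-refl
[≡1]≤[≢0] (suc (suc _)) = z≤n

[≢0]+[≡0] : ∀ x → [ x ≢0] + [ x ≡0] ≡ 1
[≢0]+[≡0] zero    = refl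
[≢0]+[≡0] (suc _) = refl

[≡0]-positive : ∀ {x} → 0 < x → [ x ≡0] ≡ 0
[≡0]-positive {suc _} _ = refl

*-[≡1] : ∀ x → x * [ x ≡1] ≡ [ x ≡1]
*-[≡1] zero          = refl
*-[≡1] (suc zero)    = refl
*-[≡1] (suc (suc x)) = *-zeroʳ (suc (suc x))

∑-1 : ∑[ i < n ] 1 ≡ n
∑-1 {zero}  = refl
∑-1 {suc n} = cong suc (∑-1 {n})

∑-mono-≤ : {f g : Vector ℕ n} → (∀ i → f i ≤ g i) → sum f ≤ sum g
∑-mono-≤ {zero}  f≤g = z≤n
∑-mono-≤ {suc n} f≤g = +-mono-≤ (f≤g zero) (∑-mono-≤ (f≤g ∘ suc))

∑-single : (f : Vector ℕ n) (j : Fin n) → (∀ i → i ≢ j → f i ≡ 0) → sum f ≡ f j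
∑-single {suc n} f j vanish = begin
  sum f                        ≡⟨ sum-remove {i = j} f ⟩
  f j + sum (removeAt f j)     ≡⟨ cong (f j +_) (trans (sum-cong-≗ (λ i → vanish _ (punchInᵢ≢i j i))) (sum-replicate-zero n)) ⟩
  f j + 0                      ≡⟨ +-identityʳ (f j) ⟩
  f j                          ∎
  where open ≡-Reasoning

∑-δ : (j : Fin n) (f : Vector ℕ n) → ∑[ i < n ] (⟦ j ≟ i ⟧ * f i) ≡ f j
∑-δ j f = trans (∑-single _ j (λ i i≢j → cong (_* f i) (⟦≟⟧-≢ (i≢j ∘ sym))))
                (trans (cong (_* f j) (⟦≟⟧-refl j)) (*-identityˡ (f j)))

∑-≢ : (j : Fin (suc n)) (f : Vector ℕ (suc n)) → ∑[ i < suc n ] (⟦ ¬? (i ≟ j) ⟧ * f i) ≡ sum (removeAt f j)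
∑-≢ j f = begin
  ∑[ i < _ ] (⟦ ¬? (i ≟ j) ⟧ * f i)
    ≡⟨ sum-remove {i = j} (λ i → ⟦ ¬? (i ≟ j) ⟧ * f i) ⟩
  ⟦ ¬? (j ≟ j) ⟧ * f j + ∑[ i < _ ] (⟦ ¬? (punchIn j i ≟ j) ⟧ * f (punchIn j i))
    ≡⟨ cong₂ _+_ (cong (λ b → 𝟙 (not b) * f j) (dec-true (j ≟ j) refl))
                 (sum-cong-≗ (λ i → trans (cong (λ b → 𝟙 (not b) * f (punchIn j i)) (dec-false (punchIn j i ≟ j) (punchInᵢ≢i j i)))
                                          (*-identityˡ (f (punchIn j i))))) ⟩
  sum (removeAt f j) ∎
  where open ≡-Reasoning

occupied : Vector ℕ r → ℕ
occupied {r} s = ∑[ i < r ] [ s i ≢0]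

singletonsExcept : Fin r → Vector ℕ r → ℕ
singletonsExcept {r} j s = ∑[ i < r ] (⟦ ¬? (i ≟ j) ⟧ * [ s i ≡1])

singletons<occupied : (t : Vector ℕ n) → n < sum t → ∑[ i < n ] [ t i ≡1] < occupied t
singletons<occupied {zero}  t ()
singletons<occupied {suc n} t n<∑t with t zero
... | zero          = singletons<occupied (t ∘ suc) (≤-trans (n≤1+n _) n<∑t)
... | suc zero      = s≤s (singletons<occupied (t ∘ suc) (+-cancelˡ-≤ 1 _ _ n<∑t))
... | suc (suc _)   = s≤s (∑-mono-≤ ([≡1]≤[≢0] ∘ t ∘ suc))

singletonsExcept<occupied : (s : Vector ℕ n) (j : Fin n) → n ≤ sum s → singletonsExcept j s < occupied s
singletonsExcept<occupied {suc n} s j n≤∑s = begin-strict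
  singletonsExcept j s                   ≡⟨ ∑-≢ j ([_≡1] ∘ s) ⟩
  ∑[ i < n ] [ t i ≡1]                   <⟨ bound (s j) (subst (suc n ≤_) (sum-remove {i = j} s) n≤∑s) ⟩
  [ s j ≢0] + occupied t                 ≡⟨ sum-remove {i = j} ([_≢0] ∘ s) ⟨
  occupied s                             ∎
  where
  open ≤-Reasoning
  t = removeAt s j
  bound : ∀ x → suc n ≤ x + sum t → ∑[ i < n ] [ t i ≡1] < [ x ≢0] + occupied t
  bound zero    n≤∑t = singletons<occupied t n≤∑t
  bound (suc _) _    = s≤s (∑-mono-≤ ([≡1]≤[≢0] ∘ t))

-- s′ arises from s by moving one unit from bin a to bin b, stated without subtraction.
occupied-shift : (s s′ : Vector ℕ r) {a b : Fin r} → a ≢ b →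
                 (∀ i → ⟦ a ≟ i ⟧ + s′ i ≡ ⟦ b ≟ i ⟧ + s i) →
                 occupied s′ + [ s a ≡1] ≡ occupied s + [ s b ≡0]
occupied-shift {r} s s′ {a} {b} a≢b shift = begin
  occupied s′ + [ s a ≡1]
    ≡⟨ cong (occupied s′ +_) (∑-δ a ([_≡1] ∘ s)) ⟨
  occupied s′ + ∑[ i < r ] (⟦ a ≟ i ⟧ * [ s i ≡1])
    ≡⟨ ∑-distrib-+ ([_≢0] ∘ s′) _ ⟨
  ∑[ i < r ] ([ s′ i ≢0] + ⟦ a ≟ i ⟧ * [ s i ≡1])
    ≡⟨ sum-cong-≗ at ⟩
  ∑[ i < r ] ([ s i ≢0] + ⟦ b ≟ i ⟧ * [ s i ≡0])
    ≡⟨ ∑-distrib-+ ([_≢0] ∘ s) _ ⟩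
  occupied s + ∑[ i < r ] (⟦ b ≟ i ⟧ * [ s i ≡0])
    ≡⟨ cong (occupied s +_) (∑-δ b ([_≡0] ∘ s)) ⟩
  occupied s + [ s b ≡0] ∎
  where
  open ≡-Reasoning
  leave : ∀ x′ x → suc x′ ≡ x → [ x′ ≢0] + 1 * [ x ≡1] ≡ [ x ≢0] + 0
  leave zero    _ refl = refl
  leave (suc _) _ refl = refl
  enter : ∀ x′ x → x′ ≡ suc x → [ x′ ≢0] + 0 ≡ [ x ≢0] + 1 * [ x ≡0]
  enter _ zero    refl = refl
  enter _ (suc _) refl = refl
  at : ∀ i → [ s′ i ≢0] + ⟦ a ≟ i ⟧ * [ s i ≡1] ≡ [ s i ≢0] + ⟦ b ≟ i ⟧ * [ s i ≡0]
  at i with a ≟ i | b ≟ i | shift i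
  ... | yes refl | yes refl | _  = contradiction refl a≢b
  ... | yes refl | no _     | eq = leave (s′ i) (s i) eq
  ... | no _     | yes refl | eq = enter (s′ i) (s i) eq
  ... | no _     | no _     | eq = cong (λ x → [ x ≢0] + 0) eq

∣∣≡∑ : (X : Subset n) → ∣ X ∣ ≡ ∑[ w < n ] 𝟙 (lookup X w)
∣∣≡∑ []          = refl
∣∣≡∑ (true ∷ X)  = cong suc (∣∣≡∑ X)
∣∣≡∑ (false ∷ X) = ∣∣≡∑ X

⟦nonempty?⟧ : (X : Subset n) → ⟦ nonempty? X ⟧ ≡ [ ∣ X ∣ ≢0]
⟦nonempty?⟧ {n} X with nonempty? X
... | yes (_ , x∈X) = sym (positive (x∈p⇒∣p-x∣<∣p∣ x∈X))
  where
  positive : ∀ {k m} → k < m → [ m ≢0] ≡ 1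
  positive {m = suc _} _ = refl
... | no  X-empty   = cong [_≢0] (sym (trans (cong ∣_∣ (Empty-unique X-empty)) (∣⊥∣≡0 n)))

∑-∈ : (X : Subset n) (c : ℕ) → ∑[ w < n ] (𝟙 (lookup X w) * c) ≡ ∣ X ∣ * c
∑-∈ X c = trans (sym (*-distribʳ-sum c (𝟙 ∘ lookup X))) (cong (_* c) (sym (∣∣≡∑ X)))

profile : (Fin n → Fin r) → Subset n → Vector ℕ r
profile p e i = ∣ e ∩ part p i ∣

profile≡∑ : (p : Fin n → Fin r) (e : Subset n) (i : Fin r) →
            profile p e i ≡ ∑[ w < n ] (𝟙 (lookup e w) * ⟦ p w ≟ i ⟧)
profile≡∑ p e i = trans (∣∣≡∑ (e ∩ part p i)) (sum-cong-≗ λ w →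
  trans (cong 𝟙 (trans (lookup-zipWith _∧_ w e (part p i))
                       (cong (lookup e w ∧_) (lookup∘tabulate (λ v → does (p v ≟ i)) w))))
        (𝟙-∧ (lookup e w) (does (p w ≟ i))))

∑-by-part : (p : Fin n → Fin r) (e : Subset n) (h : Vector ℕ r) →
            ∑[ w < n ] (𝟙 (lookup e w) * h (p w)) ≡ ∑[ i < r ] (profile p e i * h i)
∑-by-part {n} {r} p e h = begin
  ∑[ w < n ] (𝟙 (lookup e w) * h (p w))
    ≡⟨ sum-cong-≗ (λ w → cong (𝟙 (lookup e w) *_) (∑-δ (p w) h)) ⟨
  ∑[ w < n ] (𝟙 (lookup e w) * ∑[ i < r ] (⟦ p w ≟ i ⟧ * h i))
    ≡⟨ sum-cong-≗ (λ w → *-distribˡ-sum (𝟙 (lookup e w)) (λ i → ⟦ p w ≟ i ⟧ * h i)) ⟩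
  ∑[ w < n ] ∑[ i < r ] (𝟙 (lookup e w) * (⟦ p w ≟ i ⟧ * h i))
    ≡⟨ sum-cong-≗ (λ w → sum-cong-≗ (λ i → *-assoc (𝟙 (lookup e w)) ⟦ p w ≟ i ⟧ (h i))) ⟨
  ∑[ w < n ] ∑[ i < r ] (𝟙 (lookup e w) * ⟦ p w ≟ i ⟧ * h i)
    ≡⟨ ∑-comm (λ w i → 𝟙 (lookup e w) * ⟦ p w ≟ i ⟧ * h i) ⟩
  ∑[ i < r ] ∑[ w < n ] (𝟙 (lookup e w) * ⟦ p w ≟ i ⟧ * h i)
    ≡⟨ sum-cong-≗ (λ i → *-distribʳ-sum (h i) (λ w → 𝟙 (lookup e w) * ⟦ p w ≟ i ⟧)) ⟨
  ∑[ i < r ] (∑[ w < n ] (𝟙 (lookup e w) * ⟦ p w ≟ i ⟧) * h i)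
    ≡⟨ sum-cong-≗ (λ i → cong (_* h i) (profile≡∑ p e i)) ⟨
  ∑[ i < r ] (profile p e i * h i) ∎
  where open ≡-Reasoning

∑-profile : (p : Fin n → Fin r) (e : Subset n) → sum (profile p e) ≡ ∣ e ∣
∑-profile {n} {r} p e = begin
  sum (profile p e)                  ≡⟨ sum-cong-≗ (λ i → *-identityʳ (profile p e i)) ⟨
  ∑[ i < r ] (profile p e i * 1)     ≡⟨ ∑-by-part p e (λ _ → 1) ⟨
  ∑[ w < n ] (𝟙 (lookup e w) * 1)    ≡⟨ ∑-∈ e 1 ⟩
  ∣ e ∣ * 1                          ≡⟨ *-identityʳ ∣ e ∣ ⟩
  ∣ e ∣                              ∎
  where open ≡-Reasoning

own-part-occupied : (p : Fin n → Fin r) (e : Subset n) {v : Fin n} →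
                    lookup e v ≡ true → 0 < profile p e (p v)
own-part-occupied p e {v} v∈e =
  ≤-trans (s≤s z≤n) (x∈p⇒∣p-x∣<∣p∣ (x∈p∩q⁺ (lookup⇒[]= v e v∈e , lookup⇒[]= v (part p (p v)) v∈Vₚᵥ)))
  where
  v∈Vₚᵥ : lookup (part p (p v)) v ≡ true
  v∈Vₚᵥ = trans (lookup∘tabulate (λ w → does (p w ≟ p v)) v) (dec-true (p v ≟ p v) refl)

move-self : (p : Fin n → Fin r) (v : Fin n) (j : Fin r) → move p v j v ≡ j
move-self p v j rewrite dec-true (v ≟ v) refl = refl

move-other : (p : Fin n → Fin r) {v w : Fin n} (j : Fin r) → w ≢ v → move p v j w ≡ p w
move-other p {v} {w} j w≢v rewrite dec-false (w ≟ v) w≢v = refl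

profile-move : (p : Fin n → Fin r) (e : Subset n) (v : Fin n) (j i : Fin r) →
               𝟙 (lookup e v) * ⟦ p v ≟ i ⟧ + profile (move p v j) e i ≡
               𝟙 (lookup e v) * ⟦ j ≟ i ⟧ + profile p e i
profile-move {suc n} p e v j i = begin
  a + profile (move p v j) e i         ≡⟨ cong (a +_) (split (move p v j)) ⟩
  a + (term (move p v j) v + rest (move p v j))
    ≡⟨ cong (λ k → a + (𝟙 (lookup e v) * ⟦ k ≟ i ⟧ + rest (move p v j))) (move-self p v j) ⟩
  a + (b + rest (move p v j))
    ≡⟨ cong (λ x → a + (b + x)) (sum-cong-≗ (λ w → cong (λ k → 𝟙 (lookup e (punchIn v w)) * ⟦ k ≟ i ⟧)
                                                        (move-other p j (punchInᵢ≢i v w)))) ⟩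
  a + (b + rest p)                     ≡⟨ +-left-comm a b (rest p) ⟩
  b + (a + rest p)                     ≡⟨ cong (b +_) (split p) ⟨
  b + profile p e i                    ∎
  where
  open ≡-Reasoning
  a = 𝟙 (lookup e v) * ⟦ p v ≟ i ⟧
  b = 𝟙 (lookup e v) * ⟦ j ≟ i ⟧
  term : (Fin (suc n) → Fin _) → Vector ℕ (suc n)
  term q w = 𝟙 (lookup e w) * ⟦ q w ≟ i ⟧
  rest : (Fin (suc n) → Fin _) → ℕ
  rest q = sum (removeAt (term q) v)
  split : ∀ q → profile q e i ≡ term q v + rest q
  split q = trans (profile≡∑ q e i) (sum-remove {i = v} (term q))

occupied-move : (p : Fin n → Fin r) (e : Subset n) {v : Fin n} {j : Fin r} → p v ≢ j →
                occupied (profile (move p v j) e) + 𝟙 (lookup e v) * [ profile p e (p v) ≡1] ≡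
                occupied (profile p e) + 𝟙 (lookup e v) * [ profile p e j ≡0]
occupied-move p e {v} {j} pv≢j = by-membership (lookup e v) (profile-move p e v j)
  where
  open ≡-Reasoning
  s = profile p e
  s′ = profile (move p v j) e
  by-membership : ∀ b → (∀ i → 𝟙 b * ⟦ p v ≟ i ⟧ + s′ i ≡ 𝟙 b * ⟦ j ≟ i ⟧ + s i) →
                  occupied s′ + 𝟙 b * [ s (p v) ≡1] ≡ occupied s + 𝟙 b * [ s j ≡0]
  by-membership false unmoved = cong (_+ 0) (sum-cong-≗ (cong [_≢0] ∘ unmoved))
  by-membership true  moved   = begin
    occupied s′ + 1 * [ s (p v) ≡1]  ≡⟨ cong (occupied s′ +_) (*-identityˡ _) ⟩
    occupied s′ + [ s (p v) ≡1]      ≡⟨ occupied-shift s s′ pv≢j (λ i → subst₂ _≡_ (cong (_+ s′ i) (*-identityˡ _))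
                                                                                  (cong (_+ s i) (*-identityˡ _)) (moved i)) ⟩
    occupied s + [ s j ≡0]           ≡⟨ cong (occupied s +_) (*-identityˡ _) ⟨
    occupied s + 1 * [ s j ≡0]       ∎

sum-allFin : (f : Vector ℕ n) → ListAction.sum (map f (allFin n)) ≡ sum f
sum-allFin f = trans (cong ListAction.sum (List.map-tabulate (λ i → i) f)) (sum-tabulate f)
  where
  sum-tabulate : ∀ {m} (g : Vector ℕ m) → ListAction.sum (List.tabulate g) ≡ sum g
  sum-tabulate {zero}  g = refl
  sum-tabulate {suc m} g = cong (g zero +_) (sum-tabulate (g ∘ suc))

length-filter≡∑ : ∀ {a p} {A : Set a} {P : Pred A p} (P? : Decidable P) (xs : List A) →
                  length (filter P? xs) ≡ ∑[ x < length xs ] ⟦ P? (List.lookup xs x) ⟧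
length-filter≡∑ P? []       = refl
length-filter≡∑ P? (x ∷ xs) with does (P? x)
... | true  = cong suc (length-filter≡∑ P? xs)
... | false = length-filter≡∑ P? xs

deg≡∑ : (E : List (Subset n)) (X : Subset n) → deg E X ≡ ∑[ x < length E ] [ ∣ List.lookup E x ∩ X ∣ ≢0]
deg≡∑ E X = trans (length-filter≡∑ (λ e → nonempty? (e ∩ X)) E) (sum-cong-≗ (λ x → ⟦nonempty?⟧ (List.lookup E x ∩ X)))

degSum≡∑ : (E : List (Subset n)) (p : Fin n → Fin r) →
           degSum E p ≡ ∑[ x < length E ] occupied (profile p (List.lookup E x))
degSum≡∑ E p = trans (sum-allFin (λ i → deg E (part p i)))
                     (trans (sum-cong-≗ (λ i → deg≡∑ E (part p i)))
                            (∑-comm (λ i x → [ ∣ List.lookup E x ∩ part p i ∣ ≢0])))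

LocallyOptimal : List (Subset n) → (Fin n → Fin r) → Fin r → Set
LocallyOptimal E p R = ∀ v → p v ≢ R → degSum E (move p v R) ≤ degSum E p

module _ (E : List (Subset n)) (p : Fin n → Fin r) (R : Fin r) where

  private
    m = length E
    e : Fin m → Subset n
    e = List.lookup E
    s : Fin m → Vector ℕ r
    s x = profile p (e x)
    loss : Fin m → Vector ℕ r
    loss x i = ⟦ ¬? (i ≟ R) ⟧ * [ s x i ≡1]

  gain≤loss : LocallyOptimal E p R → (v : Fin n) →
              ∑[ x < m ] (𝟙 (lookup (e x) v) * [ s x R ≡0]) ≤
              ∑[ x < m ] (𝟙 (lookup (e x) v) * loss x (p v))
  gain≤loss opt v with p v ≟ R
  ... | yes pv≡R = ≤-trans (≤-reflexive (trans (sum-cong-≗ no-gain) (sum-replicate-zero m))) z≤n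
    where
    no-gain : ∀ x → 𝟙 (lookup (e x) v) * [ s x R ≡0] ≡ 0
    no-gain x rewrite sym pv≡R with lookup (e x) v in v∈eₓ
    ... | false = refl
    ... | true  = cong (1 *_) ([≡0]-positive (own-part-occupied p (e x) v∈eₓ))
  ... | no pv≢R = +-cancelˡ-≤ (∑[ x < m ] occupied (s x)) _ _ (begin
    ∑[ x < m ] occupied (s x) + gain
      ≡⟨ ∑-distrib-+ (occupied ∘ s) _ ⟨
    ∑[ x < m ] (occupied (s x) + 𝟙 (lookup (e x) v) * [ s x R ≡0])
      ≡⟨ sum-cong-≗ (λ x → occupied-move p (e x) pv≢R) ⟨
    ∑[ x < m ] (occupied (s′ x) + 𝟙 (lookup (e x) v) * [ s x (p v) ≡1])
      ≡⟨ ∑-distrib-+ (occupied ∘ s′) _ ⟩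
    ∑[ x < m ] occupied (s′ x) + ∑[ x < m ] (𝟙 (lookup (e x) v) * [ s x (p v) ≡1])
      ≤⟨ +-mono-≤ moving-does-not-help
                  (≤-reflexive (sum-cong-≗ (λ x → cong (𝟙 (lookup (e x) v) *_) (sym (*-identityˡ _))))) ⟩
    ∑[ x < m ] occupied (s x) + ∑[ x < m ] (𝟙 (lookup (e x) v) * (1 * [ s x (p v) ≡1])) ∎)
    where
    open ≤-Reasoning
    gain = ∑[ x < m ] (𝟙 (lookup (e x) v) * [ s x R ≡0])
    s′ : Fin m → Vector ℕ r
    s′ x = profile (move p v R) (e x)
    moving-does-not-help : ∑[ x < m ] occupied (s′ x) ≤ ∑[ x < m ] occupied (s x)
    moving-does-not-help = subst₂ _≤_ (degSum≡∑ E (move p v R)) (degSum≡∑ E p) (opt v pv≢R)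

  uncovered≤singletons : ∀ {u} → Uniform u E → LocallyOptimal E p R →
                         u * ∑[ x < m ] [ s x R ≡0] ≤ ∑[ x < m ] singletonsExcept R (s x)
  uncovered≤singletons {u} uniform opt = begin
    u * ∑[ x < m ] [ s x R ≡0]
      ≡⟨ *-distribˡ-sum u (λ x → [ s x R ≡0]) ⟩
    ∑[ x < m ] (u * [ s x R ≡0])
      ≡⟨ sum-cong-≗ (λ x → trans (cong (_* [ s x R ≡0]) (sym (All.lookup uniform (∈-lookup x))))
                                 (sym (∑-∈ (e x) _))) ⟩
    ∑[ x < m ] ∑[ v < n ] (𝟙 (lookup (e x) v) * [ s x R ≡0])
      ≡⟨ ∑-comm (λ x v → 𝟙 (lookup (e x) v) * [ s x R ≡0]) ⟩
    ∑[ v < n ] ∑[ x < m ] (𝟙 (lookup (e x) v) * [ s x R ≡0])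
      ≤⟨ ∑-mono-≤ (gain≤loss opt) ⟩
    ∑[ v < n ] ∑[ x < m ] (𝟙 (lookup (e x) v) * loss x (p v))
      ≡⟨ ∑-comm (λ v x → 𝟙 (lookup (e x) v) * loss x (p v)) ⟩
    ∑[ x < m ] ∑[ v < n ] (𝟙 (lookup (e x) v) * loss x (p v))
      ≡⟨ sum-cong-≗ (λ x → ∑-by-part p (e x) (loss x)) ⟩
    ∑[ x < m ] ∑[ i < r ] (s x i * loss x i)
      ≡⟨ sum-cong-≗ (λ x → sum-cong-≗ (λ i → trans (*-left-comm (s x i) ⟦ ¬? (i ≟ R) ⟧ [ s x i ≡1])
                                                    (cong (⟦ ¬? (i ≟ R) ⟧ *_) (*-[≡1] (s x i))))) ⟩
    ∑[ x < m ] singletonsExcept R (s x) ∎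
    where open ≤-Reasoning

  length+singletons≤degSum : Uniform r E → m + ∑[ x < m ] singletonsExcept R (s x) ≤ degSum E p
  length+singletons≤degSum uniform = begin
    m + ∑[ x < m ] singletonsExcept R (s x)
      ≡⟨ cong (_+ ∑[ x < m ] singletonsExcept R (s x)) (∑-1 {m}) ⟨
    ∑[ x < m ] 1 + ∑[ x < m ] singletonsExcept R (s x)
      ≡⟨ ∑-distrib-+ (λ _ → 1) (λ x → singletonsExcept R (s x)) ⟨
    ∑[ x < m ] suc (singletonsExcept R (s x))
      ≤⟨ ∑-mono-≤ (λ x → singletonsExcept<occupied (s x) R (≤-reflexive (sym (size x)))) ⟩
    ∑[ x < m ] occupied (s x)
      ≡⟨ degSum≡∑ E p ⟨
    degSum E p ∎
    where
    open ≤-Reasoning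
    size : ∀ x → sum (s x) ≡ r
    size x = trans (∑-profile p (e x)) (All.lookup uniform (∈-lookup x))

  length≡covered+uncovered : m ≡ deg E (part p R) + ∑[ x < m ] [ s x R ≡0]
  length≡covered+uncovered = begin
    m                                                     ≡⟨ ∑-1 {m} ⟨
    ∑[ x < m ] 1                                          ≡⟨ sum-cong-≗ (λ x → [≢0]+[≡0] (s x R)) ⟨
    ∑[ x < m ] ([ s x R ≢0] + [ s x R ≡0])               ≡⟨ ∑-distrib-+ (λ x → [ s x R ≢0]) (λ x → [ s x R ≡0]) ⟩
    ∑[ x < m ] [ s x R ≢0] + ∑[ x < m ] [ s x R ≡0]      ≡⟨ cong (_+ ∑[ x < m ] [ s x R ≡0]) (deg≡∑ E (part p R)) ⟨
    deg E (part p R) + ∑[ x < m ] [ s x R ≡0] ∎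
    where open ≡-Reasoning

lemma3 : (k n : ℕ) → 2 ≤ suc k → (E : List (Subset n)) → Uniform (suc k) E →
         (p : Fin n → Fin (suc k)) →
         (∀ v → p v ≢ fromℕ k → degSum E (move p v (fromℕ k)) ≤ degSum E p) →
         suc (suc k) * length E ≤ degSum E p + suc k * deg E (Defs.part p (fromℕ k))
lemma3 k n _ E uniform p opt = begin
  suc (suc k) * m            ≡⟨ cong (λ z → m + suc k * z) (length≡covered+uncovered E p R) ⟩
  m + suc k * (d + Z)        ≡⟨ cong (m +_) (*-distribˡ-+ (suc k) d Z) ⟩
  m + (suc k * d + suc k * Z) ≤⟨ +-monoʳ-≤ m (+-monoʳ-≤ (suc k * d) (uncovered≤singletons E p R uniform opt)) ⟩
  m + (suc k * d + T)        ≡⟨ trans (+-left-comm m (suc k * d) T) (+-comm (suc k * d) (m + T)) ⟩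
  m + T + suc k * d          ≤⟨ +-monoˡ-≤ (suc k * d) (length+singletons≤degSum E p R uniform) ⟩
  degSum E p + suc k * d     ∎
  where
  open ≤-Reasoning
  R = fromℕ k
  m = length E
  d = deg E (part p R)
  Z = ∑[ x < m ] [ profile p (List.lookup E x) R ≡0]
  T = ∑[ x < m ] singletonsExcept R (profile p (List.lookup E x))
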